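{- Let $T$ be a bicolored directed tree. Then $T$ has a bikernel if and only if every critical vertex of $T$ is supercritical.
   Context: A directed tree is a digraph whose underlying graph is a tree. A bicolored digraph has each arc colored $1$ or $2$. A vertex $v$ is a 1-sink if no arc of color $1$ leaves $v$, and a 2-source if no arc of color $2$ enters $v$. A vertex is critical if it is a 1-sink or a 2-source, and supercritical if it is both. A non-empty set $B\subseteq V(T)$ is a bikernel (by monochromatic paths) if: (i) for all distinct $u,v\in B$ there is no monochromatic directed $uv$-path; (ii) for every $v\in V(T)\setminus B$ there is a directed path of color $1$ from $v$ to a vertex of $B$; (iii) for every $v\in V(T)\setminus B$ there is a directed path of color $2$ from a vertex of $B$ to $v$. -}

module Defs where

open import Data.Nat using (ℕ; _≤_)
open import Data.Fin using (Fin)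
open import Data.Fin.Subset using (Subset; _∈_; _∉_)
open import Data.Maybe using (Maybe; just; nothing)
open import Data.List using (List; []; _∷_; length)
open import Data.List.Relation.Unary.Unique.Propositional using (Unique)
open import Data.Product using (Σ; ∃; ∃-syntax; _×_; _,_)
open import Data.Sum using (_⊎_)
open import Relation.Binary.PropositionalEquality using (_≡_; _≢_)
open import Relation.Nullary using (¬_)

data Color : Set where
  c1 c2 : Color

-- A bicoloured digraph on vertex set Fin n: arc u v = just c means there is
-- an arc u → v of colour c; nothing means no arc u → v.
record BiDigraph (n : ℕ) : Set where
  field
    arc : Fin n → Fin n → Maybe Color

module _ {n : ℕ} (D : BiDigraph n) where
  open BiDigraph D

  Adj : Fin n → Fin n → Set
  Adj u v = (arc u v ≢ nothing) ⊎ (arc v u ≢ nothing)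

  data UWalk : List (Fin n) → Set where
    single : (v : Fin n) → UWalk (v ∷ [])
    step   : {u v : Fin n} {vs : List (Fin n)} →
             Adj u v → UWalk (v ∷ vs) → UWalk (u ∷ v ∷ vs)

  data StartsAt : List (Fin n) → Fin n → Set where
    here : {v : Fin n} {vs : List (Fin n)} → StartsAt (v ∷ vs) v

  data EndsAt : List (Fin n) → Fin n → Set where
    last  : {v : Fin n} → EndsAt (v ∷ []) v
    there : {u v w : Fin n} {vs : List (Fin n)} →
            EndsAt (v ∷ vs) w → EndsAt (u ∷ v ∷ vs) w

  Connected : Set
  Connected = (u v : Fin n) → ∃[ vs ] (UWalk vs × StartsAt vs u × EndsAt vs v)

  IsCycle : List (Fin n) → Set
  IsCycle vs = 3 ≤ length vs × Unique vs × UWalk vs ×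
               Σ (Fin n) λ a → Σ (Fin n) λ b → StartsAt vs a × EndsAt vs b × Adj b a

  -- T is a directed tree: no loops, no pair of opposite arcs (so the
  -- underlying graph is simple), underlying graph connected and acyclic
  IsDirectedTree : Set
  IsDirectedTree =
    ((v : Fin n) → arc v v ≡ nothing) ×
    ((u v : Fin n) → arc u v ≢ nothing → arc v u ≡ nothing) ×
    Connected ×
    ((vs : List (Fin n)) → ¬ IsCycle vs)

  data CWalk (c : Color) : List (Fin n) → Set where
    single : (v : Fin n) → CWalk c (v ∷ [])
    step   : {u v : Fin n} {vs : List (Fin n)} →
             arc u v ≡ just c → CWalk c (v ∷ vs) → CWalk c (u ∷ v ∷ vs)

  CPath : Color → Fin n → Fin n → Set
  CPath c u v = ∃[ vs ] (CWalk c vs × Unique vs × StartsAt vs u × EndsAt vs v)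

  MonoPath : Fin n → Fin n → Set
  MonoPath u v = CPath c1 u v ⊎ CPath c2 u v

  OneSink : Fin n → Set
  OneSink v = (w : Fin n) → arc v w ≢ just c1

  TwoSource : Fin n → Set
  TwoSource v = (w : Fin n) → arc w v ≢ just c2

  Critical : Fin n → Set
  Critical v = OneSink v ⊎ TwoSource v

  Supercritical : Fin n → Set
  Supercritical v = OneSink v × TwoSource v

  IsBikernel : Subset n → Set
  IsBikernel B =
    (∃[ b ] b ∈ B) ×
    ((u v : Fin n) → u ∈ B → v ∈ B → u ≢ v → ¬ MonoPath u v) ×
    ((v : Fin n) → v ∉ B → ∃[ b ] (b ∈ B × CPath c1 v b)) ×
    ((v : Fin n) → v ∉ B → ∃[ b ] (b ∈ B × CPath c2 b v))

  HasBikernel : Set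
  HasBikernel = ∃[ B ] IsBikernel B

-- In a directed tree a monochromatic path never folds back onto itself: an arc
-- from its last vertex to one of its vertices would close a cycle. Hence
-- monochromatic paths can always be extended by a further arc of their colour,
-- so from every vertex a colour-1 path leads to a 1-sink and a colour-2 path
-- comes from a 2-source. If B is a bikernel, a critical vertex cannot reach B
-- by a nontrivial path in the relevant direction, so it lies in B; and a member
-- of B with an outgoing 1-arc (incoming 2-arc) would, after one more arc, reach
-- another member of B monochromatically. Conversely, when critical vertices are
-- supercritical, the set of 1-sinks is a bikernel.
module Submission where

open import Defs
open import Data.Nat using (ℕ; zero; suc; _+_; _≤_; _<_; _≤?_; z≤n; s≤s; z<s; s<s)
open import Data.Nat.Properties
  using (≤-trans; ≤-reflexive; +-identityʳ; <-≤-trans; ≤⇒≯; ≰⇒>; +-suc; +-monoˡ-≤; m≤n+m; m<m+n; n<1+n)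
open import Data.Bool using (true; false)
open import Data.Fin using (Fin) renaming (_<_ to _<ᶠ_)
open import Data.Fin.Properties using (any?; pigeonhole) renaming (_≟_ to _≟ᶠ_)
open import Data.Fin.Subset using (Subset; _∈_; _∉_)
open import Data.Fin.Subset.Properties using (_∈?_)
open import Data.Maybe using (Maybe; just; nothing)
import Data.Maybe.Properties as Maybe
open import Data.List using (List; []; _∷_; length; _++_; lookup)
open import Data.List.Properties using (length-++)
open import Data.List.Membership.Propositional using () renaming (_∈_ to _∈ₗ_; _∉_ to _∉ₗ_)
open import Data.List.Membership.Propositional.Properties using (∈-lookup)
open import Data.List.Relation.Binary.Subset.Propositional using () renaming (_⊆_ to _⊆ₗ_)
open import Data.List.Relation.Binary.Subset.Propositional.Properties using (∷⁺ʳ)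
open import Data.List.Relation.Unary.All as All using ([]; _∷_)
open import Data.List.Relation.Unary.All.Properties using (¬Any⇒All¬)
open import Data.List.Relation.Unary.Any using (here; there)
open import Data.List.Relation.Unary.Unique.Propositional using (Unique; []; _∷_)
open import Data.List.Relation.Unary.Unique.Propositional.Properties using (++⁺)
open import Data.Vec using (tabulate)
open import Data.Vec.Properties using (lookup∘tabulate; []=⇒lookup; lookup⇒[]=)
open import Function using (_∘′_)
open import Data.Product using (∃-syntax; _×_; _,_; proj₁; proj₂)
open import Data.Sum using (_⊎_; inj₁; inj₂)
open import Data.Empty using (⊥)
open import Relation.Nullary using (¬_; Dec; yes; no; contradiction)
open import Relation.Nullary.Decidable using (does; dec-true; dec-false; decidable-stable; map′; ¬?)
open import Relation.Binary.Definitions using (DecidableEquality)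
open import Relation.Binary.PropositionalEquality using (_≡_; _≢_; refl; sym; trans)

lookup-distinct : ∀ {A : Set} {xs : List A} {i j : Fin (length xs)} →
                   Unique xs → i <ᶠ j → lookup xs i ≢ lookup xs j
lookup-distinct {i = Fin.zero} {Fin.suc j} (x∉ ∷ _) _ = All.lookup x∉ (∈-lookup j)
lookup-distinct {i = Fin.suc i} {Fin.suc j} (_ ∷ uq) (s<s i<j) = lookup-distinct uq i<j

Unique⇒length≤ : ∀ {n} {vs : List (Fin n)} → Unique vs → length vs ≤ n
Unique⇒length≤ {n} {vs} uq with length vs ≤? n
... | yes ≤n = ≤n
... | no ≰n with i , j , i<j , eq ← pigeonhole (≰⇒> ≰n) (lookup vs) =
  contradiction eq (lookup-distinct uq i<j)

growth-terminates : ∀ {n} {P : List (Fin n) → Set} {Q : Set} →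
                    (∀ {vs} → P vs → Unique vs) →
                    (∀ {vs} → P vs → Q ⊎ ∃[ ws ] (P ws × length vs < length ws)) →
                    ∀ {vs} → P vs → Q
growth-terminates {n} {P} {Q} unique grow {vs} p = go (suc n) p (m≤n+m (suc n) (length vs))
  where
  go : (fuel : ℕ) → ∀ {vs} → P vs → n < length vs + fuel → Q
  go zero {vs} p bound =
    contradiction (<-≤-trans bound (≤-reflexive (+-identityʳ (length vs)))) (≤⇒≯ (Unique⇒length≤ (unique p)))
  go (suc fuel) {vs} p bound with grow p
  ... | inj₁ q = q
  ... | inj₂ (ws , pws , longer) =
    go fuel pws (≤-trans bound (≤-trans (≤-reflexive (+-suc (length vs) fuel)) (+-monoˡ-≤ fuel longer)))

_≟ᶜ_ : DecidableEquality Color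
c1 ≟ᶜ c1 = yes refl
c1 ≟ᶜ c2 = no λ ()
c2 ≟ᶜ c1 = no λ ()
c2 ≟ᶜ c2 = yes refl

just⇒≢nothing : ∀ {m : Maybe Color} {c} → m ≡ just c → m ≢ nothing
just⇒≢nothing refl ()

module Paths {n : ℕ} (D : BiDigraph n) where
  open BiDigraph D

  IsPath : Color → List (Fin n) → Fin n → Fin n → Set
  IsPath c vs u v = CWalk D c vs × Unique vs × StartsAt D vs u × EndsAt D vs v

  trivialPath : ∀ {c} v → CPath D c v v
  trivialPath v = v ∷ [] , single v , [] ∷ [] , here , last

  startsAt-∈ : ∀ {vs u} → StartsAt D vs u → u ∈ₗ vs
  startsAt-∈ here = here refl

  endsAt-∈ : ∀ {vs v} → EndsAt D vs v → v ∈ₗ vs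
  endsAt-∈ last = here refl
  endsAt-∈ (there e) = there (endsAt-∈ e)

  toUWalk : ∀ {c vs} → CWalk D c vs → UWalk D vs
  toUWalk (single v) = single v
  toUWalk (step a p) = step (inj₁ (just⇒≢nothing a)) (toUWalk p)

  firstArc : ∀ {c vs u v} → IsPath c vs u v → u ≢ v → ∃[ w ] arc u w ≡ just c
  firstArc (single _ , _ , here , last) u≢v = contradiction refl u≢v
  firstArc (step a _ , _ , here , _) _ = _ , a

  lastArc : ∀ {c vs u v} → IsPath c vs u v → u ≢ v → ∃[ w ] arc w v ≡ just c
  lastArc (single _ , _ , here , last) u≢v = contradiction refl u≢v
  lastArc (step a p , _ , here , there e) _ = into a p e
    where
    into : ∀ {c x y ys v} → arc x y ≡ just c → CWalk D c (y ∷ ys) → EndsAt D (y ∷ ys) v →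
           ∃[ w ] arc w v ≡ just c
    into a (single _) last = _ , a
    into _ (step a p) (there e) = into a p e

  suffix : ∀ {c vs u v x} → x ∈ₗ vs → IsPath c vs u v → CPath D c x v
  suffix (here refl) p@(_ , _ , here , _) = _ , p
  suffix (there x∈) (step _ p , _ ∷ uq , here , there e) = suffix x∈ (p , uq , here , e)

  prefix : ∀ {c vs u v x} → x ∈ₗ vs → IsPath c vs u v → ∃[ ws ] (IsPath c ws u x × ws ⊆ₗ vs)
  prefix (here refl) (_ , _ , here , _) =
    _ , (single _ , [] ∷ [] , here , last) , λ { (here refl) → here refl }
  prefix (there x∈) (step a p , u∉ ∷ uq , here , there e)
    with _ , (p′ , uq′ , here , e′) , ws⊆ ← prefix x∈ (p , uq , here , e) =
    _ , (step a p′ , All.tabulate (All.lookup u∉ ∘′ ws⊆) ∷ uq′ , here , there e′) , ∷⁺ʳ _ ws⊆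

  snoc : ∀ {c vs u w x} → IsPath c vs u w → arc w x ≡ just c → x ∉ₗ vs → IsPath c (vs ++ x ∷ []) u x
  snoc {vs = vs} (p , uq , here , e) a x∉ =
    walk p e a , ++⁺ uq ([] ∷ []) (λ { (x∈ , here refl) → x∉ x∈ }) , here , ends vs
    where
    walk : ∀ {c vs w x} → CWalk D c vs → EndsAt D vs w → arc w x ≡ just c → CWalk D c (vs ++ x ∷ [])
    walk (single _) last a = step a (single _)
    walk (step b p) (there e) a = step b (walk p e a)
    ends : ∀ vs {x} → EndsAt D (vs ++ x ∷ []) x
    ends [] = last
    ends (_ ∷ []) = there last
    ends (_ ∷ y ∷ ys) = there (ends (y ∷ ys))

  cons : ∀ {c vs u v x} → arc x u ≡ just c → x ∉ₗ vs → IsPath c vs u v → IsPath c (x ∷ vs) x v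
  cons a x∉ (p , uq , here , e) = step a p , ¬Any⇒All¬ _ x∉ ∷ uq , here , there e

  arcFrom? : ∀ c v → Dec (∃[ w ] arc v w ≡ just c)
  arcFrom? c v = any? (λ w → Maybe.≡-dec _≟ᶜ_ (arc v w) (just c))

  arcInto? : ∀ c v → Dec (∃[ w ] arc w v ≡ just c)
  arcInto? c v = any? (λ w → Maybe.≡-dec _≟ᶜ_ (arc w v) (just c))

module TreePaths {n : ℕ} (T : BiDigraph n) (tree : IsDirectedTree T) where
  open BiDigraph T
  open Paths T
  private
    noLoop : ∀ v → arc v v ≡ nothing
    noLoop = proj₁ tree
    noOpposite : ∀ u v → arc u v ≢ nothing → arc v u ≡ nothing
    noOpposite = proj₁ (proj₂ tree)
    acyclic : ∀ vs → ¬ IsCycle T vs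
    acyclic = proj₂ (proj₂ (proj₂ tree))

  no-closing-arc : ∀ {c vs u w} → IsPath c vs u w → arc w u ≢ nothing → ⊥
  no-closing-arc (single v , _ , here , last) wu = wu (noLoop v)
  no-closing-arc (step a (single _) , _ , here , there last) wu = wu (noOpposite _ _ (just⇒≢nothing a))
  no-closing-arc (p@(step _ (step _ _)) , uq , here , e) wu =
    acyclic _ (s≤s (s≤s (s≤s z≤n)) , uq , toUWalk p , _ , _ , here , e , inj₁ wu)

  successor∉path : ∀ {c vs u w x} → IsPath c vs u w → arc w x ≢ nothing → x ∉ₗ vs
  successor∉path p wx x∈ = no-closing-arc (proj₂ (suffix x∈ p)) wx

  predecessor∉path : ∀ {c vs u w x} → IsPath c vs w u → arc x w ≢ nothing → x ∉ₗ vs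
  predecessor∉path p xw x∈ = no-closing-arc (proj₁ (proj₂ (prefix x∈ p))) xw

  extend : ∀ {c vs u w x} → IsPath c vs u w → arc w x ≡ just c → IsPath c (vs ++ x ∷ []) u x
  extend p a = snoc p a (successor∉path p (just⇒≢nothing a))

  prepend : ∀ {c vs u w x} → arc x w ≡ just c → IsPath c vs w u → IsPath c (x ∷ vs) x u
  prepend a p = cons a (predecessor∉path p (just⇒≢nothing a)) p

  start≢successor : ∀ {c vs u w x} → IsPath c vs u w → arc w x ≢ nothing → u ≢ x
  start≢successor p@(_ , _ , s , _) wx refl = successor∉path p wx (startsAt-∈ s)

  predecessor≢end : ∀ {c vs u w x} → arc x w ≢ nothing → IsPath c vs w u → x ≢ u
  predecessor≢end xw p@(_ , _ , _ , e) refl = predecessor∉path p xw (endsAt-∈ e)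

  reachOneSink : ∀ x → ∃[ s ] (OneSink T s × CPath T c1 x s)
  reachOneSink x = growth-terminates (λ (_ , p) → proj₁ (proj₂ p)) grow (x , proj₂ (trivialPath x))
    where
    grow : ∀ {vs} → (∃[ y ] IsPath c1 vs x y) →
           (∃[ s ] (OneSink T s × CPath T c1 x s)) ⊎ ∃[ ws ] ((∃[ y ] IsPath c1 ws x y) × length vs < length ws)
    grow {vs} (y , p) with arcFrom? c1 y
    ... | no ¬out = inj₁ (y , (λ w a → ¬out (w , a)) , _ , p)
    ... | yes (w , a) =
      inj₂ (_ , (w , extend p a) , <-≤-trans (m<m+n (length vs) z<s) (≤-reflexive (sym (length-++ vs))))

  reachTwoSource : ∀ x → ∃[ s ] (TwoSource T s × CPath T c2 s x)
  reachTwoSource x = growth-terminates (λ (_ , p) → proj₁ (proj₂ p)) grow (x , proj₂ (trivialPath x))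
    where
    grow : ∀ {vs} → (∃[ y ] IsPath c2 vs y x) →
           (∃[ s ] (TwoSource T s × CPath T c2 s x)) ⊎ ∃[ ws ] ((∃[ y ] IsPath c2 ws y x) × length vs < length ws)
    grow (y , p) with arcInto? c2 y
    ... | no ¬in = inj₁ (y , (λ w a → ¬in (w , a)) , _ , p)
    ... | yes (w , a) = inj₂ (_ , (w , prepend a p) , n<1+n _)

module Bikernel {n : ℕ} (T : BiDigraph n) (tree : IsDirectedTree T) {B : Subset n} (isB : IsBikernel T B) where
  open Paths T
  open TreePaths T tree
  private
    independent : ∀ u v → u ∈ B → v ∈ B → u ≢ v → ¬ MonoPath T u v
    independent = proj₁ (proj₂ isB)
    absorbing : ∀ v → v ∉ B → ∃[ b ] (b ∈ B × CPath T c1 v b)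
    absorbing = proj₁ (proj₂ (proj₂ isB))
    dominating : ∀ v → v ∉ B → ∃[ b ] (b ∈ B × CPath T c2 b v)
    dominating = proj₂ (proj₂ (proj₂ isB))

  reach₁ : ∀ v → ∃[ b ] (b ∈ B × CPath T c1 v b)
  reach₁ v with v ∈? B
  ... | yes v∈ = v , v∈ , trivialPath v
  ... | no v∉ = absorbing v v∉

  reach₂ : ∀ v → ∃[ b ] (b ∈ B × CPath T c2 b v)
  reach₂ v with v ∈? B
  ... | yes v∈ = v , v∈ , trivialPath v
  ... | no v∉ = dominating v v∉

  critical⇒∈ : ∀ v → Critical T v → v ∈ B
  critical⇒∈ v (inj₁ sink) with b , b∈ , _ , p ← reach₁ v with v ≟ᶠ b
  ... | yes refl = b∈
  ... | no v≢b = let w , a = firstArc p v≢b in contradiction a (sink w)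
  critical⇒∈ v (inj₂ source) with b , b∈ , _ , p ← reach₂ v with b ≟ᶠ v
  ... | yes refl = b∈
  ... | no b≢v = let w , a = lastArc p b≢v in contradiction a (source w)

  ∈⇒supercritical : ∀ {v} → v ∈ B → Supercritical T v
  ∈⇒supercritical {v} v∈ = sink , source
    where
    sink : OneSink T v
    sink w a with b , b∈ , _ , p ← reach₁ w =
      independent v b v∈ b∈ (predecessor≢end (just⇒≢nothing a) p) (inj₁ (_ , prepend a p))
    source : TwoSource T v
    source w a with b , b∈ , _ , p ← reach₂ w =
      independent b v b∈ v∈ (start≢successor p (just⇒≢nothing a)) (inj₂ (_ , extend p a))

module OneSinks {n : ℕ} (T : BiDigraph n) (tree : IsDirectedTree T) where
  open Paths T
  open TreePaths T tree

  oneSink? : ∀ v → Dec (OneSink T v)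
  oneSink? v = map′ (λ ¬out w a → ¬out (w , a)) (λ sink (w , a) → sink w a) (¬? (arcFrom? c1 v))

  oneSinks : Subset n
  oneSinks = tabulate (λ v → does (oneSink? v))

  OneSink⇒∈ : ∀ {v} → OneSink T v → v ∈ oneSinks
  OneSink⇒∈ {v} sink = lookup⇒[]= v oneSinks (trans (lookup∘tabulate _ v) (dec-true (oneSink? v) sink))

  ∈⇒OneSink : ∀ {v} → v ∈ oneSinks → OneSink T v
  ∈⇒OneSink {v} v∈ = decidable-stable (oneSink? v) λ ¬sink →
    false≢true (trans (sym (dec-false (oneSink? v) ¬sink)) (trans (sym (lookup∘tabulate _ v)) ([]=⇒lookup v∈)))
    where
    false≢true : false ≢ true
    false≢true ()

  oneSinks-isBikernel : Fin n → (∀ v → Critical T v → Supercritical T v) → IsBikernel T oneSinks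
  oneSinks-isBikernel x super = nonempty , independent , absorbing , dominating
    where
    nonempty : ∃[ b ] b ∈ oneSinks
    nonempty = let s , sink , _ = reachOneSink x in s , OneSink⇒∈ sink
    independent : ∀ u v → u ∈ oneSinks → v ∈ oneSinks → u ≢ v → ¬ MonoPath T u v
    independent u v u∈ v∈ u≢v (inj₁ (_ , p)) = let w , a = firstArc p u≢v in ∈⇒OneSink u∈ w a
    independent u v u∈ v∈ u≢v (inj₂ (_ , p)) =
      let w , a = lastArc p u≢v in proj₂ (super v (inj₁ (∈⇒OneSink v∈))) w a
    absorbing : ∀ v → v ∉ oneSinks → ∃[ b ] (b ∈ oneSinks × CPath T c1 v b)
    absorbing v _ = let s , sink , p = reachOneSink v in s , OneSink⇒∈ sink , p
    dominating : ∀ v → v ∉ oneSinks → ∃[ b ] (b ∈ oneSinks × CPath T c2 b v)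
    dominating v _ = let s , source , p = reachTwoSource v in s , OneSink⇒∈ (proj₁ (super s (inj₂ source))) , p

mainTheorem10 : (n : ℕ) → 1 ≤ n → (T : BiDigraph n) → IsDirectedTree T →
    (HasBikernel T → ((v : Fin n) → Critical T v → Supercritical T v)) ×
    (((v : Fin n) → Critical T v → Supercritical T v) → HasBikernel T)
mainTheorem10 (suc _) _ T tree =
  (λ (B , isB) v crit → let open Bikernel T tree isB in ∈⇒supercritical (critical⇒∈ v crit)) ,
  (λ super → oneSinks , oneSinks-isBikernel Fin.zero super)
  where open OneSinks T tree
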